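{- For every prime $p\ge5$ and every positive integer $N$, we have $pH_{pN}\equiv H_N\pmod{p^4\mathbb{Z}_p}$ if and only if $p$ is a Wolstenholme prime or $p$ divides $N$.
   Context: $H_n=\sum_{i=1}^n1/i$. A Wolstenholme prime is a prime $p$ with $v_p(H_{p-1})\ge3$, where $v_p$ is the $p$-adic valuation. $\mathbb{Z}_p$ denotes the $p$-adic integers. -}

module Defs where

open import Data.Nat as ℕ using (ℕ; zero; suc)
open import Data.Nat.Divisibility using (_∣_)
open import Data.Integer as ℤ using (ℤ; +_)
import Data.Integer.Divisibility as ℤD
open import Data.Rational using (ℚ; 0ℚ; _+_; _-_; _*_; _/_)
open import Data.Product using (∃; ∃-syntax; _×_)
open import Relation.Nullary using (¬_)
open import Relation.Binary.PropositionalEquality using (_≡_)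

H : ℕ → ℚ
H zero    = 0ℚ
H (suc n) = H n + (+ 1 / suc n)

-- x ∈ p^k ℤ_p  (for rational x): x = a / b with b ≠ 0, p ∤ b and p^k ∣ a.
-- Equivalently v_p(x) ≥ k (with v_p(0) = ∞).
InPowZp : ℕ → ℕ → ℚ → Set
InPowZp p k x =
  ∃[ a ] ∃[ b ] Σ (ℕ.NonZero b) λ nz →
    (¬ (p ∣ b)) × ((+ (p ℕ.^ k)) ℤD.∣ a) × (x ≡ (_/_ a b {{nz}}))
  where open import Data.Product using (Σ)

CongPowZp : ℕ → ℕ → ℚ → ℚ → Set
CongPowZp p k x y = InPowZp p k (x - y)

Wolstenholme : ℕ → Set
Wolstenholme p = InPowZp p 3 (H (p ℕ.∸ 1))

{-# OPTIONS --safe #-}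

-- Write A, B, C for H_{p-1}, H^{(2)}_{p-1}, H^{(3)}_{p-1}. Pairing 1/i with 1/(p-i) and
-- expanding 1/(p-i) = -(1/i)·1/(1 - p/i) to third order gives p ∣ C and p³ ∣ 2A + pB,
-- hence p ∣ A. Expanding 1/(pn+i) around 1/i in the same way gives
-- Σ_{0<i<p} 1/(pn+i) ≡ A - pnB (mod p³). Since pH_{pN} - H_N = p Σ_{n<N} Σ_{0<i<p} 1/(pn+i),
-- summing over n with pB ≡ -2A gives pH_{pN} - H_N ≡ pN²A (mod p⁴). So the congruence
-- holds iff p³ ∣ N²A, i.e. iff p³ ∣ A or p ∣ N (using p ∣ A).

module Submission where

open import Defs

module HarmonicCongruence where

  open import Algebra.Bundles using (CommutativeRing)
  open import Data.Fin as Fin using (Fin; toℕ; opposite)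
  import Data.Fin.Properties as FinP
  open import Data.Fin.Permutation using (reverse)
  open import Data.Integer as ℤ using (ℤ; +_)
  import Data.Integer.Divisibility.Signed as ℤS
  import Data.Integer.Properties as ℤP
  import Data.Integer.Tactic.RingSolver as ℤSolver
  open import Data.Nat as ℕ using (ℕ; zero; suc; _^_; s≤s)
  open import Data.Nat.Divisibility as ℕD using (_∣_; divides)
  open import Data.Nat.Primality using (Prime; euclidsLemma; ¬prime[1])
  import Data.Nat.Properties as ℕP
  import Data.Nat.Tactic.RingSolver as ℕSolver
  open import Data.Product using (_,_)
  import Data.Rational as ℚ
  import Data.Rational.Properties as ℚP
  open import Data.Rational.Unnormalised using (ℚᵘ; mkℚᵘ; _≃_; *≡*; 0ℚᵘ; 1ℚᵘ; _+_; _*_; _-_; -_; _/_)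
  open import Data.Rational.Unnormalised.Properties as QP
    using (≃-refl; ≃-sym; ≃-trans; ≃-reflexive; +-cong; *-cong)
  open import Data.Sum using (_⊎_; inj₁; inj₂; [_,_]′)
  open import Data.Sum.Function.Propositional using (_⊎-⇔_)
  open import Function.Bundles using (_⇔_; mk⇔)
  import Function.Properties.Equivalence as ⇔
  open import Relation.Binary.PropositionalEquality using (_≡_; refl; cong; cong₂; trans; sym; subst)
  open import Relation.Nullary using (¬_; yes; no)
  open import Relation.Nullary.Decidable.Core using (dec⇒maybe)
  open import Tactic.RingSolver using (solve-∀)
  open import Tactic.RingSolver.Core.AlmostCommutativeRing using (AlmostCommutativeRing; fromCommutativeRing)

  open QP.≃-Reasoning
  open import Algebra.Properties.Semiring.Sum (CommutativeRing.semiring QP.+-*-commutativeRing)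

  ℚᵘ-ring : AlmostCommutativeRing _ _
  ℚᵘ-ring = fromCommutativeRing QP.+-*-commutativeRing (λ x → dec⇒maybe (0ℚᵘ QP.≃? x))

  ι : ℕ → ℚᵘ
  ι n = + n / 1

  ι-+ : ∀ a b → ι (a ℕ.+ b) ≃ ι a + ι b
  ι-+ a b = *≡* (trans (cong (ℤ._* + 1) (ℤP.pos-+ a b)) (scaled (+ a) (+ b)))
    where
    scaled : ∀ x y → (x ℤ.+ y) ℤ.* + 1 ≡ (x ℤ.* + 1 ℤ.+ y ℤ.* + 1) ℤ.* + 1
    scaled = ℤSolver.solve-∀

  ι-* : ∀ a b → ι (a ℕ.* b) ≃ ι a * ι b
  ι-* a b = *≡* (cong (ℤ._* + 1) (ℤP.pos-* a b))

  ι*1/ : ∀ n → ι (suc n) * (+ 1 / suc n) ≃ 1ℚᵘ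
  ι*1/ n = QP.*-inverseʳ (ι (suc n))

  ≃-by-relations : ∀ {x y e f} u v → x - y ≃ (e - 1ℚᵘ) * u + (f - 1ℚᵘ) * v →
                   e ≃ 1ℚᵘ → f ≃ 1ℚᵘ → x ≃ y
  ≃-by-relations {x} {y} {e} {f} u v x-y≃ e≃1 f≃1 = QP.p-q≃0⇒p≃q x y (begin
    x - y                                 ≈⟨ x-y≃ ⟩
    (e - 1ℚᵘ) * u + (f - 1ℚᵘ) * v         ≈⟨ +-cong (*-cong (QP.+-congˡ (- 1ℚᵘ) e≃1) (≃-refl {u}))
                                                    (*-cong (QP.+-congˡ (- 1ℚᵘ) f≃1) (≃-refl {v})) ⟩
    (1ℚᵘ - 1ℚᵘ) * u + (1ℚᵘ - 1ℚᵘ) * v    ≈⟨ vanish u v ⟩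
    0ℚᵘ ∎)
    where
    vanish : ∀ u v → (1ℚᵘ - 1ℚᵘ) * u + (1ℚᵘ - 1ℚᵘ) * v ≃ 0ℚᵘ
    vanish = solve-∀ ℚᵘ-ring

  ≃-by-relation : ∀ {x y l r} → x ≃ (l - r) + y → l ≃ r → x ≃ y
  ≃-by-relation {x} {y} {l} {r} x≃ l≃r = begin
    x             ≈⟨ x≃ ⟩
    (l - r) + y   ≈⟨ QP.+-congˡ y (QP.p≃q⇒p-q≃0 l r l≃r) ⟩
    0ℚᵘ + y       ≈⟨ QP.+-identityˡ y ⟩
    y             ∎

  inverse-expansion : ∀ r a x j → r * a ≃ 1ℚᵘ → (r + x) * j ≃ 1ℚᵘ →
                      j + x * (a * a) + (x * x * x) * (a * a * a * j) ≃ a + (x * x) * (a * a * a)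
  inverse-expansion r a x j = ≃-by-relations _ _ (identity r a x j)
    where
    identity : ∀ r a x j →
      j + x * (a * a) + (x * x * x) * (a * a * a * j) - (a + (x * x) * (a * a * a))
        ≃ (r * a - 1ℚᵘ) * (x * a * j - j - x * x * a * a * j)
          + ((r + x) * j - 1ℚᵘ) * (a - x * a * a + x * x * a * a * a)
    identity = solve-∀ ℚᵘ-ring

  reciprocal-sum : ∀ r a s b → r * a ≃ 1ℚᵘ → s * b ≃ 1ℚᵘ → a + b ≃ (r + s) * a * b
  reciprocal-sum r a s b = ≃-by-relations _ _ (identity r a s b)
    where
    identity : ∀ r a s b → a + b - (r + s) * a * b ≃ (r * a - 1ℚᵘ) * (- b) + (s * b - 1ℚᵘ) * (- a)
    identity = solve-∀ ℚᵘ-ring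

  reciprocal-product : ∀ n a q b → n * a ≃ 1ℚᵘ → (n * q) * b ≃ 1ℚᵘ → q * b ≃ a
  reciprocal-product n a q b = ≃-by-relations _ _ (identity n a q b)
    where
    identity : ∀ n a q b → q * b - a ≃ (n * a - 1ℚᵘ) * (- (q * b)) + ((n * q) * b - 1ℚᵘ) * a
    identity = solve-∀ ℚᵘ-ring

  ∑-reverse : ∀ {n} (f : Fin n → ℚᵘ) → ∑[ i < n ] f (opposite i) ≃ ∑[ i < n ] f i
  ∑-reverse f = ≃-sym (∑-permute f reverse)

  ∑-+* : ∀ {n} (f g : Fin n → ℚᵘ) c → ∑[ i < n ] (f i + c * g i) ≃ ∑[ i < n ] f i + c * ∑[ i < n ] g i
  ∑-+* f g c = ≃-trans (∑-distrib-+ f (λ i → c * g i)) (QP.+-congʳ (sum f) (≃-sym (*-distribˡ-sum c g)))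

  toℕ+toℕ-opposite : ∀ {n} (i : Fin n) → suc (toℕ i) ℕ.+ suc (toℕ (opposite i)) ≡ suc n
  toℕ+toℕ-opposite i = trans (cong (λ t → suc (toℕ i) ℕ.+ suc t) (FinP.opposite-prop i))
    (trans (ℕP.+-suc (suc (toℕ i)) _) (cong suc (ℕP.m+[n∸m]≡n (FinP.toℕ<n i))))

  Hᵘ : ℕ → ℚᵘ
  Hᵘ zero    = 0ℚᵘ
  Hᵘ (suc n) = Hᵘ n + + 1 / suc n

  Hᵘ-+ : ∀ a n → Hᵘ (a ℕ.+ n) ≃ Hᵘ a + ∑[ i < n ] (+ 1 / suc (a ℕ.+ toℕ i))
  Hᵘ-+ a zero    = ≃-trans (≃-reflexive (cong Hᵘ (ℕP.+-identityʳ a))) (≃-sym (QP.+-identityʳ (Hᵘ a)))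
  Hᵘ-+ a (suc n) = begin
    Hᵘ (a ℕ.+ suc n)                                                    ≡⟨ cong Hᵘ (ℕP.+-suc a n) ⟩
    Hᵘ (suc a ℕ.+ n)                                                    ≈⟨ Hᵘ-+ (suc a) n ⟩
    (Hᵘ a + + 1 / suc a) + ∑[ i < n ] (+ 1 / suc (suc a ℕ.+ toℕ i))     ≈⟨ QP.+-assoc (Hᵘ a) _ _ ⟩
    Hᵘ a + (+ 1 / suc a + ∑[ i < n ] (+ 1 / suc (suc a ℕ.+ toℕ i)))     ≡⟨ cong (λ s → Hᵘ a + s) (cong₂ _+_ first rest) ⟩
    Hᵘ a + ∑[ i < suc n ] (+ 1 / suc (a ℕ.+ toℕ i))                     ∎
    where
    first : + 1 / suc a ≡ + 1 / suc (a ℕ.+ 0)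
    first = cong (λ b → + 1 / suc b) (sym (ℕP.+-identityʳ a))
    rest : ∑[ i < n ] (+ 1 / suc (suc a ℕ.+ toℕ i)) ≡ ∑[ i < n ] (+ 1 / suc (a ℕ.+ suc (toℕ i)))
    rest = sum-cong-≗ {n} (λ i → cong (λ b → + 1 / suc b) (sym (ℕP.+-suc a (toℕ i))))

  toℚᵘ-H : ∀ n → ℚ.toℚᵘ (H n) ≃ Hᵘ n
  toℚᵘ-H zero    = ≃-refl
  toℚᵘ-H (suc n) = ≃-trans (ℚP.toℚᵘ-homo-+ (H n) (+ 1 ℚ./ suc n))
                           (+-cong (toℚᵘ-H n) (ℚP.toℚᵘ-fromℚᵘ (mkℚᵘ (+ 1) n)))

  toℚᵘ-pH-H : ∀ p n N → ℚ.toℚᵘ ((+ p ℚ./ 1) ℚ.* H n ℚ.- H N) ≃ ι p * Hᵘ n - Hᵘ N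
  toℚᵘ-pH-H p n N = ≃-trans (ℚP.toℚᵘ-homo-+ ((+ p ℚ./ 1) ℚ.* H n) (ℚ.- H N)) (+-cong
    (≃-trans (ℚP.toℚᵘ-homo-* (+ p ℚ./ 1) (H n)) (*-cong (ℚP.toℚᵘ-fromℚᵘ (mkℚᵘ (+ p) 0)) (toℚᵘ-H n)))
    (≃-trans (ℚP.toℚᵘ-homo‿- (H N)) (QP.-‿cong (toℚᵘ-H N))))

  module PowerDivisibility (m : ℕ) (prime : Prime (suc m)) where

    p : ℕ
    p = suc m

    infix 4 p^_∣_
    record p^_∣_ (k : ℕ) (x : ℚᵘ) : Set where
      constructor fraction
      field
        numerator     : ℤ
        denominator-1 : ℕ
        p∤denominator : ¬ p ∣ suc denominator-1
        x≃fraction    : x ≃ mkℚᵘ (+ (p ^ k) ℤ.* numerator) denominator-1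

    p∤* : ∀ {a b} → ¬ p ∣ a → ¬ p ∣ b → ¬ p ∣ a ℕ.* b
    p∤* p∤a p∤b p∣ab = [ p∤a , p∤b ]′ (euclidsLemma _ _ prime p∣ab)

    p∤1 : ¬ p ∣ 1
    p∤1 p∣1 = ¬prime[1] (subst Prime (ℕD.∣1⇒≡1 p∣1) prime)

    p^∣-resp : ∀ {k x y} → x ≃ y → p^ k ∣ x → p^ k ∣ y
    p^∣-resp x≃y (fraction c d p∤d eq) = fraction c d p∤d (≃-trans (≃-sym x≃y) eq)

    p^∣-cong : ∀ {k x y} → x ≃ y → p^ k ∣ x ⇔ p^ k ∣ y
    p^∣-cong x≃y = mk⇔ (p^∣-resp x≃y) (p^∣-resp (≃-sym x≃y))

    p^∣-0 : ∀ {k} → p^ k ∣ 0ℚᵘ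
    p^∣-0 {k} = fraction (+ 0) 0 p∤1 (≃-reflexive (cong (λ z → mkℚᵘ z 0) (sym (ℤP.*-zeroʳ (+ (p ^ k))))))

    p^∣-+ : ∀ {k x y} → p^ k ∣ x → p^ k ∣ y → p^ k ∣ x + y
    p^∣-+ {k} (fraction c d p∤d x≃) (fraction c′ d′ p∤d′ y≃) =
      fraction (c ℤ.* + suc d′ ℤ.+ c′ ℤ.* + suc d) _ (p∤* p∤d p∤d′)
        (≃-trans (+-cong x≃ y≃)
                 (≃-reflexive (cong (λ z → mkℚᵘ z _) (factor (+ (p ^ k)) c c′ (+ suc d) (+ suc d′)))))
      where
      factor : ∀ q c c′ e e′ → q ℤ.* c ℤ.* e′ ℤ.+ q ℤ.* c′ ℤ.* e ≡ q ℤ.* (c ℤ.* e′ ℤ.+ c′ ℤ.* e)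
      factor = ℤSolver.solve-∀

    p^∣-neg : ∀ {k x} → p^ k ∣ x → p^ k ∣ - x
    p^∣-neg {k} (fraction c d p∤d x≃) =
      fraction (ℤ.- c) d p∤d
        (≃-trans (QP.-‿cong x≃) (≃-reflexive (cong (λ z → mkℚᵘ z d) (ℤP.neg-distribʳ-* (+ (p ^ k)) c))))

    p^∣-sub : ∀ {k x y} → p^ k ∣ x → p^ k ∣ y → p^ k ∣ x - y
    p^∣-sub x y = p^∣-+ x (p^∣-neg y)

    +p^-+ : ∀ j k → + (p ^ j) ℤ.* + (p ^ k) ≡ + (p ^ (j ℕ.+ k))
    +p^-+ j k = trans (sym (ℤP.pos-* (p ^ j) (p ^ k))) (cong +_ (sym (ℕP.^-distribˡ-+-* p j k)))

    p^∣-* : ∀ {j k x y} → p^ j ∣ x → p^ k ∣ y → p^ (j ℕ.+ k) ∣ x * y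
    p^∣-* {j} {k} (fraction c d p∤d x≃) (fraction c′ d′ p∤d′ y≃) =
      fraction (c ℤ.* c′) _ (p∤* p∤d p∤d′)
        (≃-trans (*-cong x≃ y≃) (≃-reflexive (cong (λ z → mkℚᵘ z _)
          (trans (regroup (+ (p ^ j)) (+ (p ^ k)) c c′) (cong (ℤ._* (c ℤ.* c′)) (+p^-+ j k))))))
      where
      regroup : ∀ q q′ c c′ → q ℤ.* c ℤ.* (q′ ℤ.* c′) ≡ q ℤ.* q′ ℤ.* (c ℤ.* c′)
      regroup = ℤSolver.solve-∀

    p^∣-weaken : ∀ {j} d {x} → p^ (j ℕ.+ d) ∣ x → p^ j ∣ x
    p^∣-weaken {j} d (fraction c e p∤e x≃) = fraction (+ (p ^ d) ℤ.* c) e p∤e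
      (≃-trans x≃ (≃-reflexive (cong (λ z → mkℚᵘ z e)
        (trans (cong (ℤ._* c) (sym (+p^-+ j d))) (ℤP.*-assoc (+ (p ^ j)) (+ (p ^ d)) c)))))

    p^∣-∑ : ∀ {k n} (f : Fin n → ℚᵘ) → (∀ i → p^ k ∣ f i) → p^ k ∣ ∑[ i < n ] f i
    p^∣-∑ {n = zero}  f p^∣f = p^∣-0
    p^∣-∑ {n = suc n} f p^∣f = p^∣-+ (p^∣f Fin.zero) (p^∣-∑ (λ i → f (Fin.suc i)) (λ i → p^∣f (Fin.suc i)))

    p^0∣ι : ∀ n → p^ 0 ∣ ι n
    p^0∣ι n = fraction (+ n) 0 p∤1 (≃-reflexive (cong (λ z → mkℚᵘ z 0) (sym (ℤP.*-identityˡ (+ n)))))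

    p^0∣1/ : ∀ n → ¬ p ∣ suc n → p^ 0 ∣ + 1 / suc n
    p^0∣1/ n p∤n = fraction (+ 1) n p∤n ≃-refl

    p^1∣p : p^ 1 ∣ ι p
    p^1∣p = fraction (+ 1) 0 p∤1 (≃-reflexive (cong (λ z → mkℚᵘ z 0)
      (trans (cong +_ (sym (ℕP.*-identityʳ p))) (sym (ℤP.*-identityʳ (+ (p ^ 1)))))))

    InPowZp⇔p^∣ : ∀ k q → InPowZp p k q ⇔ p^ k ∣ ℚ.toℚᵘ q
    InPowZp⇔p^∣ k q = mk⇔ to from
      where
      to : InPowZp p k q → p^ k ∣ ℚ.toℚᵘ q
      to (a , suc b , _ , p∤b , p^k∣a , q≡a/b) with ℤS.∣ᵤ⇒∣ p^k∣a
      ... | ℤS.divides c a≡cp^k = fraction c b p∤b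
        (≃-trans (ℚP.toℚᵘ-cong q≡a/b) (≃-trans (ℚP.toℚᵘ-fromℚᵘ (mkℚᵘ a b))
          (≃-reflexive (cong (λ z → mkℚᵘ z b) (trans a≡cp^k (ℤP.*-comm c (+ (p ^ k))))))))
      from : p^ k ∣ ℚ.toℚᵘ q → InPowZp p k q
      from (fraction c b p∤b q≃) = + (p ^ k) ℤ.* c , suc b , _ , p∤b ,
        ℤS.∣⇒∣ᵤ (ℤS.divides c (ℤP.*-comm (+ (p ^ k)) c)) , trans (sym (ℚP.fromℚᵘ-toℚᵘ q)) (ℚP.fromℚᵘ-cong q≃)

    1/*ι*-cancel : ∀ n x → (+ 1 / suc n) * (ι (suc n) * x) ≃ x
    1/*ι*-cancel n x = begin
      (+ 1 / suc n) * (ι (suc n) * x) ≈⟨ ≃-sym (QP.*-assoc (+ 1 / suc n) (ι (suc n)) x) ⟩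
      ((+ 1 / suc n) * ι (suc n)) * x ≈⟨ QP.*-congʳ {x} (≃-trans (QP.*-comm (+ 1 / suc n) (ι (suc n))) (ι*1/ n)) ⟩
      1ℚᵘ * x                         ≈⟨ QP.*-identityˡ x ⟩
      x                               ∎

    p^∣-cancel-unit : ∀ {k} u {x} → ¬ p ∣ suc u → p^ k ∣ ι (suc u) * x → p^ k ∣ x
    p^∣-cancel-unit u {x} p∤u p^∣ux = p^∣-resp (1/*ι*-cancel u x) (p^∣-* (p^0∣1/ u p∤u) p^∣ux)

    p^∣-cancel-p : ∀ {k x} → p^ (suc k) ∣ ι p * x → p^ k ∣ x
    p^∣-cancel-p {k} {x} (fraction c d p∤d px≃) = fraction c d p∤d (begin
      x                                                ≈⟨ ≃-sym (1/*ι*-cancel m x) ⟩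
      (+ 1 / p) * (ι p * x)                            ≈⟨ *-cong (≃-refl {+ 1 / p}) px≃ ⟩
      (+ 1 / p) * mkℚᵘ (+ (p ^ suc k) ℤ.* c) d         ≈⟨ *≡* cross-multiplied ⟩
      mkℚᵘ (+ (p ^ k) ℤ.* c) d                         ∎)
      where
      regroup : ∀ q q′ c e → + 1 ℤ.* ((q ℤ.* q′) ℤ.* c) ℤ.* e ≡ (q′ ℤ.* c) ℤ.* (q ℤ.* e)
      regroup = ℤSolver.solve-∀
      cross-multiplied : + 1 ℤ.* (+ (p ℕ.* p ^ k) ℤ.* c) ℤ.* + suc d ≡ (+ (p ^ k) ℤ.* c) ℤ.* + (p ℕ.* suc d)
      cross-multiplied = trans (cong (λ z → + 1 ℤ.* (z ℤ.* c) ℤ.* + suc d) (ℤP.pos-* p (p ^ k)))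
        (trans (regroup (+ p) (+ (p ^ k)) c (+ suc d)) (cong ((+ (p ^ k) ℤ.* c) ℤ.*_) (sym (ℤP.pos-* p (suc d)))))

    p^∣-+-cancelʳ : ∀ {k x y} → p^ k ∣ x + y → p^ k ∣ y → p^ k ∣ x
    p^∣-+-cancelʳ {x = x} {y} p^∣x+y p^∣y = p^∣-resp (identity x y) (p^∣-sub p^∣x+y p^∣y)
      where
      identity : ∀ x y → x + y - y ≃ x
      identity = solve-∀ ℚᵘ-ring

    p^∣-diff⇔ : ∀ {k x y} → p^ k ∣ x - y → p^ k ∣ x ⇔ p^ k ∣ y
    p^∣-diff⇔ {x = x} {y} p^∣x-y = mk⇔
      (λ p^∣x → p^∣-resp (identity₁ x y) (p^∣-sub p^∣x p^∣x-y))
      (λ p^∣y → p^∣-resp (identity₂ x y) (p^∣-+ p^∣x-y p^∣y))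
      where
      identity₁ : ∀ x y → x - (x - y) ≃ y
      identity₁ = solve-∀ ℚᵘ-ring
      identity₂ : ∀ x y → (x - y) + y ≃ x
      identity₂ = solve-∀ ℚᵘ-ring

  module OddPrime (m : ℕ) (prime : Prime (suc m)) (p∤2 : ¬ suc m ∣ 2) where

    open PowerDivisibility m prime

    recip : ∀ {n} → Fin n → ℚᵘ
    recip i = + 1 / suc (toℕ i)

    A B C : ℚᵘ
    A = ∑[ i < m ] recip i
    B = ∑[ i < m ] (recip i * recip i)
    C = ∑[ i < m ] (recip i * recip i * recip i)

    p∤1+ : ∀ {n} → n ℕ.< m → ¬ p ∣ suc n
    p∤1+ n<m p∣1+n = ℕP.<⇒≱ (s≤s n<m) (ℕD.∣⇒≤ p∣1+n)

    p∤pN+1+ : ∀ N {n} → n ℕ.< m → ¬ p ∣ suc (p ℕ.* N ℕ.+ n)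
    p∤pN+1+ N {n} n<m p∣pN+1+n =
      p∤1+ n<m (ℕD.∣m+n∣m⇒∣n (subst (p ∣_) (sym (ℕP.+-suc (p ℕ.* N) n)) p∣pN+1+n) (ℕD.m∣m*n N))

    p^0∣recip : (i : Fin m) → p^ 0 ∣ recip i
    p^0∣recip i = p^0∣1/ (toℕ i) (p∤1+ (FinP.toℕ<n i))

    ι-complement : (i : Fin m) → ι (suc (toℕ i)) + ι (suc (toℕ (opposite i))) ≃ ι p
    ι-complement i = ≃-trans (≃-sym (ι-+ (suc (toℕ i)) _)) (≃-reflexive (cong ι (toℕ+toℕ-opposite i)))

    p^∣-halve : ∀ {k x} → p^ k ∣ x + x → p^ k ∣ x
    p^∣-halve {x = x} p^∣2x = p^∣-cancel-unit 1 p∤2 (p^∣-resp (doubling x) p^∣2x)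
      where
      doubling : ∀ x → x + x ≃ (1ℚᵘ + 1ℚᵘ) * x
      doubling = solve-∀ ℚᵘ-ring

    -- 1/i³ + 1/(p-i)³ is a multiple of 1/i + 1/(p-i) = p/(i(p-i)).
    p^1∣C : p^ 1 ∣ C
    p^1∣C = p^∣-halve (p^∣-resp sum-of-pairs (p^∣-∑ _ pair))
      where
      factorisation : ∀ a b → a * a * a + b * b * b ≃ (a + b) * (a * a - a * b + b * b)
      factorisation = solve-∀ ℚᵘ-ring
      cubes : Fin m → ℚᵘ
      cubes i = recip i * recip i * recip i + recip (opposite i) * recip (opposite i) * recip (opposite i)
      pair : (i : Fin m) → p^ 1 ∣ cubes i
      pair i = p^∣-resp (≃-sym factored) (p^∣-* (p^∣-* (p^∣-* p^1∣p p^0∣a) p^0∣b) p^0∣quadratic)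
        where
        a b : ℚᵘ
        a = recip i
        b = recip (opposite i)
        p^0∣a : p^ 0 ∣ a
        p^0∣a = p^0∣recip i
        p^0∣b : p^ 0 ∣ b
        p^0∣b = p^0∣recip (opposite i)
        p^0∣quadratic : p^ 0 ∣ a * a - a * b + b * b
        p^0∣quadratic = p^∣-+ (p^∣-sub (p^∣-* p^0∣a p^0∣a) (p^∣-* p^0∣a p^0∣b)) (p^∣-* p^0∣b p^0∣b)
        a+b≃pab : a + b ≃ ι p * a * b
        a+b≃pab = ≃-trans (reciprocal-sum (ι (suc (toℕ i))) a (ι (suc (toℕ (opposite i)))) b
                                          (ι*1/ (toℕ i)) (ι*1/ (toℕ (opposite i))))
                          (*-cong (*-cong (ι-complement i) (≃-refl {a})) (≃-refl {b}))
        factored : a * a * a + b * b * b ≃ ι p * a * b * (a * a - a * b + b * b)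
        factored = ≃-trans (factorisation a b) (*-cong a+b≃pab (≃-refl {a * a - a * b + b * b}))
      sum-of-pairs : ∑[ i < m ] cubes i ≃ C + C
      sum-of-pairs = ≃-trans (∑-distrib-+ {m} _ _) (QP.+-congʳ C (∑-reverse {m} (λ i → recip i * recip i * recip i)))

    p^3∣A+A+pB : p^ 3 ∣ (A + A) + ι p * B
    p^3∣A+A+pB = p^∣-+-cancelʳ (p^∣-resp sum-of-pairs (p^∣-∑ _ pair)) (p^∣-* (p^∣-* p^1∣p p^1∣p) p^1∣C)
      where
      P : ℚᵘ
      P = ι p
      terms : Fin m → ℚᵘ
      terms i = ((recip (opposite i) + recip i) + P * (recip i * recip i)) + (P * P) * (recip i * recip i * recip i)
      pair : (i : Fin m) → p^ 3 ∣ terms i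
      pair i = p^∣-resp (≃-sym expanded) (p^∣-* (p^∣-* (p^∣-* p^1∣p p^1∣p) p^1∣p)
                                                (p^∣-* (p^∣-* (p^∣-* p^0∣a p^0∣a) p^0∣a) (p^0∣recip (opposite i))))
        where
        r a b : ℚᵘ
        r = ι (suc (toℕ i))
        a = recip i
        b = recip (opposite i)
        p^0∣a : p^ 0 ∣ a
        p^0∣a = p^0∣recip i
        negate-both : ∀ r a → (- r) * (- a) ≃ r * a
        negate-both = solve-∀ ℚᵘ-ring
        cancel : ∀ r s → - r + (r + s) ≃ s
        cancel = solve-∀ ℚᵘ-ring
        -r+P≃s : - r + P ≃ ι (suc (toℕ (opposite i)))
        -r+P≃s = ≃-trans (QP.+-congʳ (- r) (≃-sym (ι-complement i))) (cancel r _)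
        -- the third-order expansion of 1/(p-i) = 1/(-i + p) around 1/(-i)
        expansion : b + P * (- a * - a) + (P * P * P) * (- a * - a * - a * b) ≃ - a + (P * P) * (- a * - a * - a)
        expansion = inverse-expansion (- r) (- a) P b (≃-trans (negate-both r a) (ι*1/ (toℕ i)))
                                      (≃-trans (*-cong -r+P≃s (≃-refl {b})) (ι*1/ (toℕ (opposite i))))
        regroup : ∀ a b P → ((b + a) + P * (a * a)) + (P * P) * (a * a * a)
          ≃ ((b + P * (- a * - a) + (P * P * P) * (- a * - a * - a * b)) - (- a + (P * P) * (- a * - a * - a)))
            + (P * P * P) * (a * a * a * b)
        regroup = solve-∀ ℚᵘ-ring
        expanded : ((b + a) + P * (a * a)) + (P * P) * (a * a * a) ≃ (P * P * P) * (a * a * a * b)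
        expanded = ≃-by-relation (regroup a b P) expansion
      sum-of-pairs : ∑[ i < m ] terms i ≃ ((A + A) + P * B) + (P * P) * C
      sum-of-pairs = begin
        ∑[ i < m ] terms i
          ≈⟨ ∑-+* {m} _ _ (P * P) ⟩
        ∑[ i < m ] ((recip (opposite i) + recip i) + P * (recip i * recip i)) + (P * P) * C
          ≈⟨ QP.+-congˡ _ (∑-+* {m} _ _ P) ⟩
        (∑[ i < m ] (recip (opposite i) + recip i) + P * B) + (P * P) * C
          ≈⟨ QP.+-congˡ _ (QP.+-congˡ _ (≃-trans (∑-distrib-+ {m} _ _) (QP.+-congˡ A (∑-reverse {m} recip)))) ⟩
        ((A + A) + P * B) + (P * P) * C ∎

    p^1∣A : p^ 1 ∣ A
    p^1∣A = p^∣-halve (p^∣-+-cancelʳ (p^∣-weaken 2 p^3∣A+A+pB) (p^∣-* p^1∣p p^0∣B))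
      where
      p^0∣B : p^ 0 ∣ B
      p^0∣B = p^∣-∑ _ (λ i → p^∣-* (p^0∣recip i) (p^0∣recip i))

    block : ℕ → ℚᵘ
    block N = ∑[ i < m ] (+ 1 / suc (p ℕ.* N ℕ.+ toℕ i))

    p^3∣block-A+pNB : ∀ N → p^ 3 ∣ block N - A + (ι p * ι N) * B
    p^3∣block-A+pNB N = p^∣-resp (≃-sym (≃-by-relation (regroup (block N) A B C S x) summed))
      (p^∣-sub (p^∣-* (p^∣-* p^1∣x p^1∣x) p^1∣C) (p^∣-* (p^∣-* (p^∣-* p^1∣x p^1∣x) p^1∣x) p^0∣S))
      where
      x : ℚᵘ
      x = ι p * ι N
      j : Fin m → ℚᵘ
      j i = + 1 / suc (p ℕ.* N ℕ.+ toℕ i)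
      S : ℚᵘ
      S = ∑[ i < m ] (recip i * recip i * recip i * j i)
      p^1∣x : p^ 1 ∣ x
      p^1∣x = p^∣-* p^1∣p (p^0∣ι N)
      p^0∣S : p^ 0 ∣ S
      p^0∣S = p^∣-∑ _ (λ i → p^∣-* (p^∣-* (p^∣-* (p^0∣recip i) (p^0∣recip i)) (p^0∣recip i))
                                   (p^0∣1/ _ (p∤pN+1+ N (FinP.toℕ<n i))))
      shifted : (i : Fin m) → (ι (suc (toℕ i)) + x) * j i ≃ 1ℚᵘ
      shifted i = ≃-trans (*-cong (≃-trans (QP.+-congʳ (ι (suc (toℕ i))) (≃-sym (ι-* p N)))
                                   (≃-trans (≃-sym (ι-+ (suc (toℕ i)) (p ℕ.* N)))
                                            (≃-reflexive (cong (λ n → ι (suc n)) (ℕP.+-comm (toℕ i) (p ℕ.* N))))))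
                                  (≃-refl {j i}))
                          (ι*1/ (p ℕ.* N ℕ.+ toℕ i))
      summed : block N + x * B + (x * x * x) * S ≃ A + (x * x) * C
      summed = begin
        block N + x * B + (x * x * x) * S
          ≈⟨ ≃-sym (≃-trans (∑-+* {m} _ _ (x * x * x)) (QP.+-congˡ _ (∑-+* {m} _ _ x))) ⟩
        ∑[ i < m ] (j i + x * (recip i * recip i) + (x * x * x) * (recip i * recip i * recip i * j i))
          ≈⟨ sum-cong-≋ {m} (λ i → inverse-expansion (ι (suc (toℕ i))) (recip i) x (j i)
                                                      (ι*1/ (toℕ i)) (shifted i)) ⟩
        ∑[ i < m ] (recip i + (x * x) * (recip i * recip i * recip i))
          ≈⟨ ∑-+* {m} _ _ (x * x) ⟩
        A + (x * x) * C ∎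
      regroup : ∀ f A B C S x → f - A + x * B
        ≃ ((f + x * B + (x * x * x) * S) - (A + (x * x) * C)) + ((x * x) * C - (x * x * x) * S)
      regroup = solve-∀ ℚᵘ-ring

    harmonic-defect : ℕ → ℚᵘ
    harmonic-defect N = ι p * Hᵘ (p ℕ.* N) - Hᵘ N - ι p * (ι N * ι N * A)

    Hᵘ-p*suc : ∀ N → Hᵘ (p ℕ.* suc N) ≃ (Hᵘ (p ℕ.* N) + block N) + + 1 / suc (p ℕ.* N ℕ.+ m)
    Hᵘ-p*suc N = ≃-trans (≃-reflexive (cong Hᵘ (p*suc m N))) (QP.+-congˡ _ (Hᵘ-+ (p ℕ.* N) m))
      where
      p*suc : ∀ m N → suc m ℕ.* suc N ≡ suc (suc m ℕ.* N ℕ.+ m)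
      p*suc = ℕSolver.solve-∀

    p*1/pN+p : ∀ N → ι p * (+ 1 / suc (p ℕ.* N ℕ.+ m)) ≃ + 1 / suc N
    p*1/pN+p N = reciprocal-product (ι (suc N)) (+ 1 / suc N) (ι p) L (ι*1/ N)
      (≃-trans (*-cong (≃-trans (≃-sym (ι-* (suc N) p)) (≃-reflexive (cong ι (suc*p m N)))) (≃-refl {L}))
               (ι*1/ (p ℕ.* N ℕ.+ m)))
      where
      L : ℚᵘ
      L = + 1 / suc (p ℕ.* N ℕ.+ m)
      suc*p : ∀ m N → suc N ℕ.* suc m ≡ suc (suc m ℕ.* N ℕ.+ m)
      suc*p = ℕSolver.solve-∀

    p^4∣harmonic-defect : ∀ N → p^ 4 ∣ harmonic-defect N
    p^4∣harmonic-defect zero = p^∣-resp (≃-sym (≃-trans p*0≡0 (vanishes (ι p) A))) p^∣-0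
      where
      p*0≡0 : harmonic-defect 0 ≃ ι p * Hᵘ 0 - 0ℚᵘ - ι p * (0ℚᵘ * 0ℚᵘ * A)
      p*0≡0 = ≃-reflexive (cong (λ n → ι p * Hᵘ n - 0ℚᵘ - ι p * (0ℚᵘ * 0ℚᵘ * A)) (ℕP.*-zeroʳ p))
      vanishes : ∀ P A → P * 0ℚᵘ - 0ℚᵘ - P * (0ℚᵘ * 0ℚᵘ * A) ≃ 0ℚᵘ
      vanishes = solve-∀ ℚᵘ-ring
    p^4∣harmonic-defect (suc N) = p^∣-resp (≃-sym step)
      (p^∣-sub (p^∣-+ (p^4∣harmonic-defect N) (p^∣-* p^1∣p (p^3∣block-A+pNB N)))
             (p^∣-* (p^∣-* p^1∣p (p^0∣ι N)) p^3∣A+A+pB))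
      where
      P n h L J : ℚᵘ
      P = ι p
      n = ι N
      h = Hᵘ (p ℕ.* N)
      L = + 1 / suc (p ℕ.* N ℕ.+ m)
      J = + 1 / suc N
      regroup : ∀ P h f L H J n A B →
        P * ((h + f) + L) - (H + J) - P * ((1ℚᵘ + n) * (1ℚᵘ + n) * A)
          ≃ (P * L - J)
            + ((P * h - H - P * (n * n * A)) + P * (f - A + (P * n) * B) - (P * n) * ((A + A) + P * B))
      regroup = solve-∀ ℚᵘ-ring
      step : harmonic-defect (suc N)
             ≃ harmonic-defect N + P * (block N - A + (P * n) * B) - (P * n) * ((A + A) + P * B)
      step = begin
        P * Hᵘ (p ℕ.* suc N) - (Hᵘ N + J) - P * (ι (suc N) * ι (suc N) * A)
          ≈⟨ +-cong (QP.+-congˡ (- (Hᵘ N + J)) (*-cong (≃-refl {P}) (Hᵘ-p*suc N)))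
                    (QP.-‿cong (*-cong (≃-refl {P}) (*-cong (*-cong (ι-+ 1 N) (ι-+ 1 N)) (≃-refl {A})))) ⟩
        P * ((h + block N) + L) - (Hᵘ N + J) - P * ((1ℚᵘ + n) * (1ℚᵘ + n) * A)
          ≈⟨ ≃-by-relation (regroup P h (block N) L (Hᵘ N) J n A B) (p*1/pN+p N) ⟩
        harmonic-defect N + P * (block N - A + (P * n) * B) - (P * n) * ((A + A) + P * B) ∎

    p^4∣pH-H⇔p^3∣N²A : ∀ N → p^ 4 ∣ ι p * Hᵘ (p ℕ.* N) - Hᵘ N ⇔ p^ 3 ∣ ι N * ι N * A
    p^4∣pH-H⇔p^3∣N²A N = ⇔.trans (p^∣-diff⇔ (p^4∣harmonic-defect N)) (mk⇔ p^∣-cancel-p (p^∣-* p^1∣p))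

    p^3∣N²A⇔p^3∣A⊎p∣N : ∀ N → p^ 3 ∣ ι N * ι N * A ⇔ ((p^ 3 ∣ A) ⊎ p ∣ N)
    p^3∣N²A⇔p^3∣A⊎p∣N N = mk⇔ (to N) from
      where
      to : ∀ N → p^ 3 ∣ ι N * ι N * A → (p^ 3 ∣ A) ⊎ p ∣ N
      to zero _ = inj₂ (p ℕD.∣0)
      to (suc N) p^3∣N²A with p ℕD.∣? suc N
      ... | yes p∣N = inj₂ p∣N
      ... | no  p∤N = inj₁ (p^∣-cancel-unit N p∤N (p^∣-cancel-unit N p∤N
                             (p^∣-resp (QP.*-assoc (ι (suc N)) (ι (suc N)) A) p^3∣N²A)))
      from : (p^ 3 ∣ A) ⊎ p ∣ N → p^ 3 ∣ ι N * ι N * A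
      from (inj₁ p^3∣A) = p^∣-* (p^∣-* (p^0∣ι N) (p^0∣ι N)) p^3∣A
      from (inj₂ (divides q refl)) =
        p^∣-resp (≃-sym regrouped) (p^∣-* (p^∣-* p^1∣p p^1∣p) (p^∣-* (p^∣-* (p^0∣ι q) (p^0∣ι q)) p^1∣A))
        where
        reorder : ∀ q P A → (q * P) * (q * P) * A ≃ (P * P) * ((q * q) * A)
        reorder = solve-∀ ℚᵘ-ring
        regrouped : ι (q ℕ.* p) * ι (q ℕ.* p) * A ≃ (ι p * ι p) * ((ι q * ι q) * A)
        regrouped = ≃-trans (*-cong (*-cong (ι-* q p) (ι-* q p)) (≃-refl {A})) (reorder (ι q) (ι p) A)

    Hᵘ-p-1≃A : Hᵘ m ≃ A
    Hᵘ-p-1≃A = ≃-trans (Hᵘ-+ 0 m) (QP.+-identityˡ A)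

    Wolstenholme⇔p^3∣A : Wolstenholme p ⇔ p^ 3 ∣ A
    Wolstenholme⇔p^3∣A = ⇔.trans (InPowZp⇔p^∣ 3 (H m)) (p^∣-cong (≃-trans (toℚᵘ-H m) Hᵘ-p-1≃A))

    harmonic-congruence : ∀ N →
      CongPowZp p 4 ((+ p ℚ./ 1) ℚ.* H (p ℕ.* N)) (H N) ⇔ (Wolstenholme p ⊎ p ∣ N)
    harmonic-congruence N =
      ⇔.trans (InPowZp⇔p^∣ 4 _) (
      ⇔.trans (p^∣-cong (toℚᵘ-pH-H p (p ℕ.* N) N)) (
      ⇔.trans (p^4∣pH-H⇔p^3∣N²A N) (
      ⇔.trans (p^3∣N²A⇔p^3∣A⊎p∣N N)
              (⇔.sym (Wolstenholme⇔p^3∣A ⊎-⇔ ⇔.refl)))))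

open import Data.Nat using (ℕ; _≤_; _*_; NonZero)
open import Data.Nat.Primality using (Prime)
open import Data.Nat.Divisibility using (_∣_)
open import Data.Rational using (ℚ) renaming (_*_ to _*ℚ_)
open import Data.Sum using (_⊎_)
open import Function.Bundles using (_⇔_)
open import Data.Integer using (+_)
open import Data.Rational using (_/_)
open import Data.Nat using (zero; suc; s≤s; z≤n)
open import Data.Nat.Properties using (<⇒≱; ≤-trans)
open import Data.Nat.Divisibility using (∣⇒≤)
open import Relation.Nullary using (¬_)

lemma18 : (p N : ℕ) → Prime p → 5 ≤ p → 1 ≤ N →
    CongPowZp p 4 ((+ p / 1) *ℚ H (p * N)) (H N) ⇔ (Wolstenholme p ⊎ p ∣ N)
lemma18 zero    N _ ()
lemma18 (suc m) N p-prime 5≤p _ = HarmonicCongruence.OddPrime.harmonic-congruence m p-prime p∤2 N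
  where
  p∤2 : ¬ suc m ∣ 2
  p∤2 p∣2 = <⇒≱ (≤-trans (s≤s (s≤s (s≤s z≤n))) 5≤p) (∣⇒≤ p∣2)
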